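{- Let $\mathcal{N}$ be a sorting network with $n$ levels. Then the brick polytope $\Omega(\mathcal{N})\subset\mathbb{R}^n$ is contained in the hyperplane of equation $\sum_{i=1}^n x_i = D(\mathcal{N})$, where $D(\mathcal{N})$ is the sum of the depths of all the bricks of $\mathcal{N}$.
   Context: A network $\mathcal{N}$ with $n$ levels and $m$ commutators consists of $n$ horizontal lines (levels), labeled $1,\dots,n$ from bottom to top, together with $m$ vertical segments (commutators), each joining two consecutive levels, such that no two commutators share an endpoint. The bricks of $\mathcal{N}$ are its $m-n+1$ bounded cells. The depth of a brick is the number of levels located above it. A pseudoline is an abscissa-monotone path in $\mathcal{N}$ (running from left to right along the levels and possibly passing to an adjacent level through a commutator). A contact between two pseudolines is a commutator whose two endpoints lie one on each pseudoline; a crossing between two pseudolines is a commutator traversed by both. A pseudoline arrangement supported by $\mathcal{N}$ is a set of $n$ pseudolines on $\mathcal{N}$ such that any two of them have exactly one crossing, possibly some contacts, and no other intersection; its $i$-th pseudoline is the one starting at level $i$ on the left (it ends at level $n+1-i$). $\mathcal{N}$ is sorting if it supports at least one pseudoline arrangement; $\mathrm{arr}(\mathcal{N})$ is the set of these arrangements. The brick vector $\omega(\Lambda)\in\mathbb{R}^n$ of $\Lambda\in\mathrm{arr}(\mathcal{N})$ has $i$-th coordinate equal to the number of bricks of $\mathcal{N}$ located below the $i$-th pseudoline of $\Lambda$, and the brick polytope is $\Omega(\mathcal{N})=\mathrm{conv}\{\omega(\Lambda):\Lambda\in\mathrm{arr}(\mathcal{N})\}$. -}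

module Defs where

open import Data.Nat using (ℕ; zero; suc; _<_; _≤_; _∸_; _≟_)
open import Data.Nat.Properties using (_≤?_)
open import Data.Fin as Fin using (Fin; toℕ; inject₁; fromℕ; opposite)
open import Data.Fin.Properties using (any?)
open import Data.List using (List; length; lookup; filter; map; allFin)
open import Data.Nat.ListAction using (sum)
open import Data.Product using (Σ; ∃; _×_; _,_; proj₁)
open import Data.Sum using (_⊎_)
open import Relation.Binary.PropositionalEquality using (_≡_; _≢_)
open import Relation.Nullary using (Dec; yes; no; ¬_)
open import Relation.Nullary.Decidable using (_×-dec_)
open import Data.Fin.Properties using () renaming (_<?_ to _<ᶠ?_)

-- Conventions: levels are indexed 0 .. n-1 from bottom to top
-- (level i here = level i+1 of the paper).
-- A commutator is given by the index k of its lower endpoint level: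
-- it joins levels k and k+1 (so k+1 < n).
Commutator : ℕ → Set
Commutator n = Σ ℕ (λ k → suc k < n)

gap : ∀ {n} → Commutator n → ℕ
gap = proj₁

-- A network: its commutators listed from left to right (by abscissa;
-- commutators with equal abscissa share no endpoint and commute).
Network : ℕ → Set
Network n = List (Commutator n)

Joins : ∀ {n} → Commutator n → Fin n → Fin n → Set
Joins c a b = (toℕ a ≡ gap c × toℕ b ≡ suc (gap c))
            ⊎ (toℕ b ≡ gap c × toℕ a ≡ suc (gap c))

-- A pseudoline: level t = level occupied after passing the first t
-- commutators.
record Pseudoline {n : ℕ} (N : Network n) : Set where
  field
    level : Fin (suc (length N)) → Fin n
    step  : (t : Fin (length N)) →
            level (inject₁ t) ≡ level (Fin.suc t)
            ⊎ Joins (lookup N t) (level (inject₁ t)) (level (Fin.suc t))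

open Pseudoline public

Traverses : ∀ {n} {N : Network n} → Pseudoline N → Fin (length N) → Set
Traverses p t = level p (inject₁ t) ≢ level p (Fin.suc t)

Crossing : ∀ {n} {N : Network n} → Pseudoline N → Pseudoline N → Fin (length N) → Set
Crossing p q t = Traverses p t × Traverses q t

record Arrangement {n : ℕ} (N : Network n) : Set where
  field
    line     : Fin n → Pseudoline N
    start    : ∀ i → level (line i) Fin.zero ≡ i
    end      : ∀ i → level (line i) (fromℕ (length N)) ≡ opposite i
    -- no intersection other than crossings and contacts: at every
    -- abscissa, distinct pseudolines occupy distinct levels
    disjoint : ∀ t i j → level (line i) t ≡ level (line j) t → i ≡ j
    crossing : ∀ i j → i ≢ j →
               Σ (Fin (length N)) λ t →
                 Crossing (line i) (line j) t
                 × (∀ t' → Crossing (line i) (line j) t' → t' ≡ t)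

open Arrangement public

Sorting : ∀ {n} → Network n → Set
Sorting N = Arrangement N

-- Bricks: the bounded cells.  Each brick lies between two consecutive
-- commutators on the same gap k (between levels k and k+1); we identify
-- it with the position t of its left commutator.
BrickAt : ∀ {n} (N : Network n) → Fin (length N) → Set
BrickAt N t = ∃ λ t' → t Fin.< t' × gap (lookup N t') ≡ gap (lookup N t)

brickAt? : ∀ {n} (N : Network n) (t : Fin (length N)) → Dec (BrickAt N t)
brickAt? N t = any? (λ t' → (t <ᶠ? t') ×-dec (gap (lookup N t') ≟ gap (lookup N t)))

bricks : ∀ {n} (N : Network n) → List (Fin (length N))
bricks N = filter (brickAt? N) (allFin (length N))

-- depth of a brick on gap k: number of levels above it, i.e. levels
-- k+1, ..., n-1
depth : ∀ {n} (N : Network n) → Fin (length N) → ℕ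
depth {n} N t = n ∸ suc (gap (lookup N t))

D : ∀ {n} → Network n → ℕ
D N = sum (map (depth N) (bricks N))

-- brick starting at t lies below pseudoline p iff, just right of the
-- t-th commutator (hence all along the brick), p is at a level ≥ k+1
BelowLine : ∀ {n} {N : Network n} → Pseudoline N → Fin (length N) → Set
BelowLine {N = N} p t = suc (gap (lookup N t)) ≤ toℕ (level p (Fin.suc t))

belowLine? : ∀ {n} {N : Network n} (p : Pseudoline N) (t : Fin (length N)) → Dec (BelowLine p t)
belowLine? {N = N} p t = suc (gap (lookup N t)) ≤? toℕ (level p (Fin.suc t))

ω : ∀ {n} {N : Network n} → Arrangement N → Fin n → ℕ
ω {N = N} Λ i = length (filter (belowLine? (line Λ i)) (bricks N))

coordSum : ∀ {n} → (Fin n → ℕ) → ℕ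
coordSum {n} x = sum (map x (allFin n))

-- Double counting: ∑ᵢ ωᵢ(Λ) counts the pairs (brick, pseudoline above it).
-- Just right of the left commutator of a brick on gap k, the n pseudolines
-- occupy n distinct levels, i.e. all of them, so exactly the n ∸ (k + 1)
-- pseudolines on levels k + 1, …, n − 1 pass above the brick: its depth.

module Submission where

open import Defs
open import Data.Bool using (true; false; if_then_else_)
open import Data.Fin as Fin using (Fin; toℕ; punchIn; punchOut)
open import Data.Fin.Properties using (punchIn-punchOut; punchOut-injective; suc-injective)
open import Data.List using (List; []; _∷_; length; filter; lookup; map; tabulate)
open import Data.List.Properties using (map-tabulate; map-cong)
open import Data.Nat using (ℕ; zero; suc; _+_; _∸_)
open import Data.Nat.ListAction using (sum)
open import Data.Nat.Properties using (+-0-commutativeMonoid; _≤?_)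
open import Function using (_∘_; id)
open import Function.Definitions using (Injective)
open import Relation.Binary.PropositionalEquality
open import Relation.Nullary using (Dec; does)
open import Relation.Unary using (Pred; Decidable)

open import Algebra.Properties.CommutativeMonoid.Sum +-0-commutativeMonoid
  using (sum-remove; ∑-distrib-+; sum-cong-≗; sum-replicate-zero)
  renaming (sum to ∑)

indicator : ∀ {p} {P : Set p} → Dec P → ℕ
indicator P? = if does P? then 1 else 0

length-filter≡sum-indicator : ∀ {a p} {A : Set a} {P : Pred A p} (P? : Decidable P) (xs : List A) →
                              length (filter P? xs) ≡ sum (map (indicator ∘ P?) xs)
length-filter≡sum-indicator P? [] = refl
length-filter≡sum-indicator P? (x ∷ xs) with does (P? x)
... | true  = cong suc (length-filter≡sum-indicator P? xs)
... | false = length-filter≡sum-indicator P? xs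

coordSum≡∑ : ∀ {n} (x : Fin n → ℕ) → coordSum x ≡ ∑ x
coordSum≡∑ x = trans (cong sum (map-tabulate id x)) (sum-tabulate x)
  where
  sum-tabulate : ∀ {n} (x : Fin n → ℕ) → sum (tabulate x) ≡ ∑ x
  sum-tabulate {zero}  x = refl
  sum-tabulate {suc n} x = cong (x Fin.zero +_) (sum-tabulate (x ∘ Fin.suc))

∑-sum-comm : ∀ {n} {A : Set} (f : Fin n → A → ℕ) (xs : List A) →
             ∑ (λ i → sum (map (f i) xs)) ≡ sum (map (λ x → ∑ (λ i → f i x)) xs)
∑-sum-comm {n} f []       = sum-replicate-zero n
∑-sum-comm     f (x ∷ xs) = trans (∑-distrib-+ (λ i → f i x) (λ i → sum (map (f i) xs)))
                                  (cong (∑ (λ i → f i x) +_) (∑-sum-comm f xs))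

∑-injective-reindex : ∀ {n} (σ : Fin n → Fin n) → Injective _≡_ _≡_ σ →
                      (f : Fin n → ℕ) → ∑ (f ∘ σ) ≡ ∑ f
∑-injective-reindex {zero}  σ σ-inj f = refl
∑-injective-reindex {suc n} σ σ-inj f = begin
    f j + ∑ (f ∘ σ ∘ Fin.suc)
  ≡⟨ cong (f j +_) (sum-cong-≗ (λ i → cong f (sym (punchIn-punchOut (j≢σ[1+i] i))))) ⟩
    f j + ∑ (f ∘ punchIn j ∘ σ′)
  ≡⟨ cong (f j +_) (∑-injective-reindex σ′ σ′-inj (f ∘ punchIn j)) ⟩
    f j + ∑ (f ∘ punchIn j)
  ≡⟨ sym (sum-remove f) ⟩
    ∑ f ∎
  where
  open ≡-Reasoning
  j = σ Fin.zero
  j≢σ[1+i] : ∀ i → j ≢ σ (Fin.suc i)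
  j≢σ[1+i] i e with () ← σ-inj e
  σ′ : Fin n → Fin n
  σ′ i = punchOut (j≢σ[1+i] i)
  σ′-inj : Injective _≡_ _≡_ σ′
  σ′-inj e = suc-injective (σ-inj (punchOut-injective (j≢σ[1+i] _) (j≢σ[1+i] _) e))

∑-indicator-≤ : ∀ n m → ∑ {n} (λ j → indicator (m ≤? toℕ j)) ≡ n ∸ m
∑-indicator-≤ zero    zero    = refl
∑-indicator-≤ zero    (suc m) = refl
∑-indicator-≤ (suc n) zero    = cong suc (∑-indicator-≤ n zero)
-- m is split so that the boolean test `suc m ≤ᵇ suc (toℕ j)` reduces to `m ≤ᵇ toℕ j`.
∑-indicator-≤ (suc n) (suc zero)    = ∑-indicator-≤ n zero
∑-indicator-≤ (suc n) (suc (suc m)) = ∑-indicator-≤ n (suc m)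

linesAbove≡depth : ∀ {n} {N : Network n} (Λ : Arrangement N) (b : Fin (length N)) →
                   ∑ (λ i → indicator (belowLine? (line Λ i) b)) ≡ depth N b
linesAbove≡depth {n} {N} Λ b = trans
  (∑-injective-reindex (λ i → level (line Λ i) (Fin.suc b)) (disjoint Λ (Fin.suc b) _ _)
                       (λ j → indicator (suc (gap (lookup N b)) ≤? toℕ j)))
  (∑-indicator-≤ n (suc (gap (lookup N b))))

lemma2p4 : (n : ℕ) (N : Network n) → Sorting N →
    (Λ : Arrangement N) → coordSum (ω Λ) ≡ D N
lemma2p4 n N _ Λ = begin
    coordSum (ω Λ)
  ≡⟨ coordSum≡∑ (ω Λ) ⟩
    ∑ (ω Λ)
  ≡⟨ sum-cong-≗ (λ i → length-filter≡sum-indicator (belowLine? (line Λ i)) (bricks N)) ⟩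
    ∑ (λ i → sum (map (indicator ∘ belowLine? (line Λ i)) (bricks N)))
  ≡⟨ ∑-sum-comm (λ i → indicator ∘ belowLine? (line Λ i)) (bricks N) ⟩
    sum (map (λ b → ∑ (λ i → indicator (belowLine? (line Λ i) b))) (bricks N))
  ≡⟨ cong sum (map-cong (linesAbove≡depth Λ) (bricks N)) ⟩
    D N ∎
  where open ≡-Reasoning
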